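{- Let $S$ be a set of states, each $s\in S$ assigning a value $s(\mathrm{pc})\in\mathbb{N}$ to the program counter, and let $\to\subseteq S\times S$ be a binary relation. Let $n,x_0,x_\omega\in\mathbb{N}$ and $P\subseteq S$. Assume every $s\in S$ belongs to $\mathrm{EvAtPc}_{\to}(n,x_0,x_\omega,P)$. Then for all $Q\subseteq S$ and $F\subseteq S\times S$: if $\mathrm{Ensures}_{\to}(P^{pc},Q^{pc},F)$ holds then $\mathrm{EnsuresN}_{\to}(P^{pc},Q^{pc},F,\lambda s.\,n)$ holds, where $P^{pc}=\{s\in P\mid s(\mathrm{pc})=x_0\}$ and $Q^{pc}=\{s\in Q\mid s(\mathrm{pc})=x_\omega\}$.
   Context: For $n\in\mathbb{N}$, $\to^n$ denotes the $n$-fold composition of $\to$, with $\to^0$ the identity relation on $S$. For $Q\subseteq S$, $\mathrm{Ev}_{\to}(Q)\subseteq S$ is the least set closed under: (1) if $s\in Q$ then $s\in\mathrm{Ev}_{\to}(Q)$; (2) if there exists $s'$ with $s\to s'$ and every $s'$ with $s\to s'$ lies in $\mathrm{Ev}_{\to}(Q)$, then $s\in\mathrm{Ev}_{\to}(Q)$. For $n\in\mathbb{N}$, $\mathrm{EvN}_{\to}(n,Q)=\{s\in S\mid (\forall s'.\ s\to^n s'\Rightarrow s'\in Q)\wedge(\forall s'\,\forall l<n.\ s\to^l s'\Rightarrow\exists s''.\ s'\to s'')\}$. $\mathrm{Ensures}_{\to}(P,Q,F)$ means: for all $s\in P$, $s\in\mathrm{Ev}_{\to}(\{s'\mid s'\in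 Q\wedge(s,s')\in F\})$. $\mathrm{EnsuresN}_{\to}(P,Q,F,c)$ means: for all $s\in P$, $s\in\mathrm{EvN}_{\to}(c(s),\{s'\mid s'\in Q\wedge(s,s')\in F\})$. $\mathrm{EvAtPc}_{\to}(n,x_0,x_\omega,P)$ is the set of $s\in S$ such that for every $F\subseteq S\times S$: if $s(\mathrm{pc})=x_0$ and $s\in P$ and $s\in\mathrm{Ev}_{\to}(\{s'\mid s'(\mathrm{pc})=x_\omega\wedge(s,s')\in F\})$, then $s\in\mathrm{EvN}_{\to}(n,\{s'\mid s'(\mathrm{pc})=x_\omega\wedge(s,s')\in F\})$. -}

module Defs where

open import Data.Nat using (ℕ; zero; suc; _<_)
open import Data.Product using (Σ; ∃; _×_; _,_)
open import Relation.Binary.PropositionalEquality using (_≡_)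

module _ {S : Set} where

  Pred : Set₁
  Pred = S → Set

  Rel : Set₁
  Rel = S → S → Set

  Iter : Rel → ℕ → Rel
  Iter R zero    s s' = s ≡ s'
  Iter R (suc n) s s' = Σ S λ t → R s t × Iter R n t s'

  data Ev (R : Rel) (Q : Pred) : S → Set where
    ev-here : ∀ {s} → Q s → Ev R Q s
    ev-step : ∀ {s} → (Σ S λ s' → R s s') → (∀ s' → R s s' → Ev R Q s') → Ev R Q s

  EvN : Rel → ℕ → Pred → Pred
  EvN R n Q s = (∀ s' → Iter R n s s' → Q s')
              × (∀ s' l → l < n → Iter R l s s' → Σ S λ s'' → R s' s'')

  Target : Pred → Rel → S → Pred
  Target Q F s s' = Q s' × F s s'

  Ensures : Rel → Pred → Pred → Rel → Set
  Ensures R P Q F = ∀ s → P s → Ev R (Target Q F s) s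

  EnsuresN : Rel → Pred → Pred → Rel → (S → ℕ) → Set
  EnsuresN R P Q F c = ∀ s → P s → EvN R (c s) (Target Q F s) s

  EvAtPc : (S → ℕ) → Rel → ℕ → ℕ → ℕ → Pred → S → Set₁
  EvAtPc pc R n x₀ xω P s =
    (F : Rel) → pc s ≡ x₀ → P s →
    Ev R (λ s' → pc s' ≡ xω × F s s') s →
    EvN R n (λ s' → pc s' ≡ xω × F s s') s

  AtPc : (S → ℕ) → ℕ → Pred → Pred
  AtPc pc x P s = P s × pc s ≡ x

{-# OPTIONS --safe #-}
module Submission where

open import Data.Nat using (ℕ)
open import Data.Product using (_×_; _,_; map₁)
open import Relation.Binary.PropositionalEquality using (_≡_)
open import Relation.Unary using (_⊆_)
open import Defs

-- EvAtPc quantifies over every F, so it applies to the relation Target Q F,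
-- once the pc condition on the target is moved out of AtPc.

module _ {S : Set} {R : Rel {S}} where

  Ev-mono : {A B : Pred {S}} → A ⊆ B → Ev R A ⊆ Ev R B
  Ev-mono A⊆B (ev-here a)        = ev-here (A⊆B a)
  Ev-mono A⊆B (ev-step step all) = ev-step step (λ s' r → Ev-mono A⊆B (all s' r))

  EvN-mono : {A B : Pred {S}} (n : ℕ) → A ⊆ B → EvN R n A ⊆ EvN R n B
  EvN-mono n A⊆B = map₁ (λ reach s' it → A⊆B (reach s' it))

module _ {S : Set} (pc : S → ℕ) (x : ℕ) (Q : Pred {S}) (F : Rel {S}) (s : S) where

  PcTarget : Pred {S}
  PcTarget s' = pc s' ≡ x × Target Q F s s'

  Target-AtPc⇒PcTarget : Target (AtPc pc x Q) F s ⊆ PcTarget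
  Target-AtPc⇒PcTarget ((q , pc≡x) , f) = pc≡x , q , f

  PcTarget⇒Target-AtPc : PcTarget ⊆ Target (AtPc pc x Q) F s
  PcTarget⇒Target-AtPc (pc≡x , q , f) = (q , pc≡x) , f

lemma6 : {S : Set} (pc : S → ℕ) (R : S → S → Set) (n x₀ xω : ℕ) (P : S → Set) →
    (∀ s → EvAtPc pc R n x₀ xω P s) →
    (Q : S → Set) (F : S → S → Set) →
    Ensures R (AtPc pc x₀ P) (AtPc pc xω Q) F →
    EnsuresN R (AtPc pc x₀ P) (AtPc pc xω Q) F (λ _ → n)
lemma6 pc R n x₀ xω P evAtPc Q F ensures s s∈P@(p , pc≡x₀) =
  EvN-mono n (PcTarget⇒Target-AtPc pc xω Q F s) bounded
  where
  bounded : EvN R n (PcTarget pc xω Q F s) s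
  bounded = evAtPc s (Target Q F) pc≡x₀ p
    (Ev-mono (Target-AtPc⇒PcTarget pc xω Q F s) (ensures s s∈P))
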